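{- Let $n\ge 3$. The $6(n-2)$ tournaments $E_{2n+1}^{2k+1}$, $F_{2n+1}^{2k+1}$, $(F_{2n+1}^{2k+1})^*$, $G_{2n+1}^{2k+1}$, $(G_{2n+1}^{2k+1})^*$, $H_{2n+1}^{2k+1}$, for $k\in\{1,\dots,n-2\}$, are pairwise non-isomorphic.
   Context: A tournament $T=(S,A)$ consists of a finite set $S$ and a set $A$ of ordered pairs of distinct elements of $S$ such that for all distinct $x,y\in S$ exactly one of $(x,y),(y,x)$ lies in $A$; write $x\to y$ for $(x,y)\in A$. The dual $T^*$ of $T$ is obtained by reversing every arc. Two tournaments are isomorphic if there is a bijection between vertex sets preserving arcs. For an integer $p\ge1$, the tournaments $U_{2p+1}$ and $V_{2p+1}$ on $\{0,\dots,2p\}$ are: in $U_{2p+1}$, for $i<j$, $i\to j$ if $i$ or $j$ is odd, and $j\to i$ if $i$ and $j$ are both even; in $V_{2p+1}$, $i\to j$ for $0\le i<j\le 2p-1$, and for $0\le i\le 2p-1$, $2p\to i$ if $i$ is even and $i\to 2p$ if $i$ is odd. For $n\ge 3$ and $1\le k\le n-2$, the tournaments below are on $\{0,\dots,2n\}$; put $P=\{0,\dots,2k\}$, $Q=\{2k+2,\dots,2n\}$. In each, every vertex of $P$ dominates $2k+1$ and $2k+1$ dominates every vertex of $Q$. Further: (E) $E_{2n+1}^{2k+1}$: on $P$, $i\to j$ iff $i<j$; on $Q$, $i\to j$ iff $i<j$; for $x\in Q$, $y\in P$: $x\to y$ if $x,y$ are both even, and $y\to x$ otherwise. (F) $F_{2n+1}^{2k+1}$: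 on $P$ the arcs of $U_{2k+1}$; on $Q$ and between $Q$ and $P$ as in $E_{2n+1}^{2k+1}$. (G) $G_{2n+1}^{2k+1}$: on $P$ the arcs of $U_{2k+1}$; on $Q$: $i\to j$ for $2k+2\le i<j\le 2n-1$, and for $j\in\{2k+2,\dots,2n-1\}$, $2n\to j$ if $j$ is even, $j\to 2n$ if $j$ is odd; for $x\in Q$, $y\in P$: $x\to y$ if $x=2n$ and $y$ is even, and $y\to x$ otherwise. (H) $H_{2n+1}^{2k+1}$: on $P$ the arcs of $V_{2k+1}$; on $Q$ as in $G_{2n+1}^{2k+1}$; for $x\in Q$, $y\in P$: $x\to y$ if $x=2n$ and $y=2k$, and $y\to x$ otherwise. -}

module Defs where

open import Data.Bool using (Bool; true; false; not; _∧_; _∨_; if_then_else_)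
open import Data.Nat using (ℕ; suc; _+_; _*_; _<ᵇ_; _≡ᵇ_; _≤ᵇ_)
open import Data.Fin using (Fin; toℕ)
open import Data.Product using (Σ)
open import Function.Bundles using (Bijection; _⤖_)
open import Relation.Binary.PropositionalEquality using (_≡_)

-- Tournaments on vertex set Fin m, given by their arc relation
-- (arc x y ≡ true  means  x → y).  All concrete tournaments below are
-- irreflexive and satisfy: for x ≠ y exactly one of arc x y, arc y x.

record Tournament (m : ℕ) : Set where
  field
    arc : Fin m → Fin m → Bool
open Tournament public

dual : ∀ {m} → Tournament m → Tournament m
arc (dual T) x y = arc T y x

_≅_ : ∀ {m m'} → Tournament m → Tournament m' → Set
_≅_ {m} {m'} T T' =
  Σ (Fin m ⤖ Fin m') λ f →
    ∀ x y → arc T x y ≡ arc T' (Bijection.to f x) (Bijection.to f y)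

-- Building an arc relation on ℕ from the "forward" rule:
-- fwd i j (for i < j) is true iff i → j.

even odd : ℕ → Bool
even 0 = true
even (suc n) = not (even n)
odd n = not (even n)

fromFwd : (ℕ → ℕ → Bool) → ℕ → ℕ → Bool
fromFwd fwd i j =
  if i <ᵇ j then fwd i j
  else if j <ᵇ i then not (fwd j i)
  else false

fwdU : ℕ → ℕ → Bool
fwdU i j = odd i ∨ odd j

fwdV : ℕ → ℕ → ℕ → Bool
fwdV p i j = if j ≡ᵇ (2 * p) then odd i else true

U V : (p : ℕ) → Tournament (suc (2 * p))
arc (U p) x y = fromFwd fwdU (toℕ x) (toℕ y)
arc (V p) x y = fromFwd (fwdV p) (toℕ x) (toℕ y)

-- Generic construction on {0,…,2n} with P = {0..2k}, centre 2k+1,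
-- Q = {2k+2..2n}: given forward rules on P, between P and Q (i ∈ P,
-- j ∈ Q; true means i → j), and on Q.
fwdGen : (n k : ℕ) → (ℕ → ℕ → Bool) → (ℕ → ℕ → Bool) → (ℕ → ℕ → Bool)
       → ℕ → ℕ → Bool
fwdGen n k pP cross qQ i j =
  if j ≤ᵇ (2 * k) then pP i j
  else if j ≡ᵇ suc (2 * k) then true
  else if i ≤ᵇ (2 * k) then cross i j
  else if i ≡ᵇ suc (2 * k) then true
  else qQ i j

fwdTrans : ℕ → ℕ → Bool
fwdTrans i j = true

crossEF : ℕ → ℕ → Bool
crossEF i j = not (even i ∧ even j)

crossG : ℕ → ℕ → ℕ → Bool
crossG n i j = not ((j ≡ᵇ (2 * n)) ∧ even i)

crossH : ℕ → ℕ → ℕ → ℕ → Bool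
crossH n k i j = not ((j ≡ᵇ (2 * n)) ∧ (i ≡ᵇ (2 * k)))

fwdQGH : ℕ → ℕ → ℕ → Bool
fwdQGH n i j = if j ≡ᵇ (2 * n) then odd i else true

mkT : (n : ℕ) → (ℕ → ℕ → Bool) → Tournament (suc (2 * n))
arc (mkT n fwd) x y = fromFwd fwd (toℕ x) (toℕ y)

E F G H : (n k : ℕ) → Tournament (suc (2 * n))
E n k = mkT n (fwdGen n k fwdTrans crossEF fwdTrans)
F n k = mkT n (fwdGen n k fwdU crossEF fwdTrans)
G n k = mkT n (fwdGen n k fwdU (crossG n) (fwdQGH n))
H n k = mkT n (fwdGen n k (fwdV k) (crossH n k) (fwdQGH n))

data Kind : Set where
  kE kF kF* kG kG* kH : Kind

family : Kind → (n k : ℕ) → Tournament (suc (2 * n))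
family kE  n k = E n k
family kF  n k = F n k
family kF* n k = dual (F n k)
family kG  n k = G n k
family kG* n k = dual (G n k)
family kH  n k = H n k

module Submission where

-- Call y the sole out-neighbour of x if x → y is the only arc leaving x.  An isomorphism
-- preserves these arcs, whether two of them form a path x → y → z, and the out-degrees of
-- their heads; applied to the dual, the same holds for sole in-neighbours.  Writing
-- n = k + r + 2, the only such arc of E and F is 2n−1 → 2n and the only one of their duals
-- is 1 → 0; G and H contain the path 2n−2 → 2n−1 → 2n, the dual of H contains
-- 1 → 0 → 2k, while the dual of G has only 1 → 0.  So the paths separate {E, F, F*}, G, G*
-- and H, and the out-degree of a head (k + 1, r + 2 or n) separates E, F, F* and recovers k.

open import Defs
open import Data.Bool using (Bool; true; false; not; _∧_; if_then_else_)
open import Data.Bool.Properties using (not-involutive; ¬-not; ∧-identityʳ; ∧-zeroʳ)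
open import Data.Nat using (ℕ; zero; suc; _+_; _*_; _∸_; _≤_; _<_; z≤n; s≤s; z<s; s<s; _<ᵇ_; _≡ᵇ_; _≤ᵇ_)
open import Data.Nat.Properties
open import Data.Nat.Tactic.RingSolver using (solve-∀)
open import Data.Fin using (Fin; toℕ; fromℕ<)
open import Data.Fin.Properties using (toℕ<n; toℕ-fromℕ<; toℕ-injective)
open import Data.Product using (∃; _×_; _,_; proj₁; proj₂)
open import Data.Sum using (_⊎_; inj₁; inj₂; [_,_]′)
open import Relation.Binary.Definitions using (tri<; tri≈; tri>)
open import Data.Empty using (⊥-elim)
open import Data.Unit using (⊤; tt)
open import Function using (flip; _∘_)
open import Function.Bundles using (Inverse; _↔_)
open import Function.Properties.Bijection using (⤖⇒↔)
open import Function.Properties.Inverse using (Inverse⇒Bijection)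
open import Function.Construct.Symmetry using (↔-sym)
open import Relation.Nullary using (¬_)
open import Relation.Nullary.Reflects using (Reflects; ofʸ; ofⁿ; det)
open import Relation.Binary.PropositionalEquality
import Algebra.Properties.CommutativeMonoid.Sum as MonoidSum
open MonoidSum +-0-commutativeMonoid using (sum; sum-permute; sum-cong-≗)

fromBool : Bool → ℕ
fromBool true  = 1
fromBool false = 0

outdeg : ∀ {m} → Tournament m → Fin m → ℕ
outdeg T x = sum (λ y → fromBool (arc T x y))

SoleOut : ∀ {m} → Tournament m → Fin m → Fin m → Set
SoleOut T x y = arc T x y ≡ true × (∀ z → arc T x z ≡ true → z ≡ y)

SoleOutChain : ∀ {m} → Tournament m → Set
SoleOutChain T = ∃ λ x → ∃ λ y → ∃ λ z → SoleOut T x y × SoleOut T y z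

SoleOutDegree : ∀ {m} → Tournament m → ℕ → Set
SoleOutDegree T d = ∃ λ x → ∃ λ y → SoleOut T x y × outdeg T y ≡ d

module _ {m} {T T′ : Tournament m} (iso : T ≅ T′) where

  private
    π : Fin m ↔ Fin m
    π = ⤖⇒↔ (proj₁ iso)
    open Inverse π using (to; from; strictlyInverseˡ)

    arc-to : ∀ x y → arc T x y ≡ arc T′ (to x) (to y)
    arc-to = proj₂ iso

    arc-from : ∀ x y → arc T′ x y ≡ arc T (from x) (from y)
    arc-from x y = sym (trans (arc-to (from x) (from y))
                              (cong₂ (arc T′) (strictlyInverseˡ x) (strictlyInverseˡ y)))

  ≅-sym : T′ ≅ T
  ≅-sym = Inverse⇒Bijection (↔-sym π) , arc-from

  outdeg-≅ : ∀ x → outdeg T x ≡ outdeg T′ (to x)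
  outdeg-≅ x = trans (sum-cong-≗ (λ y → cong fromBool (arc-to x y)))
                     (sym (sum-permute (λ y → fromBool (arc T′ (to x) y)) π))

  soleOut-≅ : ∀ {x y} → SoleOut T x y → SoleOut T′ (to x) (to y)
  soleOut-≅ {x} {y} (x→y , only-y) = trans (sym (arc-to x y)) x→y , λ z x→z →
    trans (sym (strictlyInverseˡ z))
          (cong to (only-y (from z)
            (trans (arc-to x (from z)) (trans (cong (arc T′ (to x)) (strictlyInverseˡ z)) x→z))))

  soleOutChain-≅ : SoleOutChain T → SoleOutChain T′
  soleOutChain-≅ (_ , _ , _ , x→y , y→z) = _ , _ , _ , soleOut-≅ x→y , soleOut-≅ y→z

  soleOutDegree-≅ : ∀ {d} → SoleOutDegree T d → SoleOutDegree T′ d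
  soleOutDegree-≅ (_ , y , x→y , deg) = _ , _ , soleOut-≅ x→y , trans (sym (outdeg-≅ y)) deg

dual-≅ : ∀ {m} {T T′ : Tournament m} → T ≅ T′ → dual T ≅ dual T′
dual-≅ (f , arc-to) = f , λ x y → arc-to y x

count : (ℕ → Bool) → ℕ → ℕ
count f zero    = 0
count f (suc m) = fromBool (f 0) + count (λ i → f (suc i)) m

count-cong : ∀ m {f g : ℕ → Bool} → (∀ i → i < m → f i ≡ g i) → count f m ≡ count g m
count-cong zero    f≗g = refl
count-cong (suc m) f≗g =
  cong₂ _+_ (cong fromBool (f≗g 0 z<s)) (count-cong m (λ i i<m → f≗g (suc i) (s<s i<m)))

count-none : ∀ m {f : ℕ → Bool} → (∀ i → i < m → f i ≡ false) → count f m ≡ 0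
count-none zero    none = refl
count-none (suc m) none rewrite none 0 z<s = count-none m (λ i i<m → none (suc i) (s<s i<m))

count-unique : ∀ m {f : ℕ → Bool} {j} → j < m → f j ≡ true →
  (∀ i → i < m → f i ≡ true → i ≡ j) → count f m ≡ 1
count-unique (suc m) {f} {zero} _ f0 only-0 rewrite f0 =
  cong suc (count-none m (λ i i<m → ¬-not (λ fi → 1+n≢0 (only-0 (suc i) (s<s i<m) fi))))
count-unique (suc m) {f} {suc j} (s<s j<m) fj only-j with f 0 in f0
... | true  = ⊥-elim (0≢1+n (only-j 0 z<s f0))
... | false = count-unique m j<m fj (λ i i<m fi → suc-injective (only-j (suc i) (s<s i<m) fi))

count-+ : ∀ a b (f : ℕ → Bool) → count f (a + b) ≡ count f a + count (λ i → f (a + i)) b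
count-+ zero    b f = refl
count-+ (suc a) b f = trans (cong (fromBool (f 0) +_) (count-+ a b (λ i → f (suc i))))
                            (sym (+-assoc (fromBool (f 0)) _ _))

count-snoc : ∀ m (f : ℕ → Bool) → count f (suc m) ≡ count f m + fromBool (f m)
count-snoc m f = begin
  count f (suc m)                          ≡⟨ cong (count f) (+-comm 1 m) ⟩
  count f (m + 1)                          ≡⟨ count-+ m 1 f ⟩
  count f m + (fromBool (f (m + 0)) + 0)   ≡⟨ cong (count f m +_) (+-identityʳ _) ⟩
  count f m + fromBool (f (m + 0))         ≡⟨ cong (λ i → count f m + fromBool (f i)) (+-identityʳ m) ⟩
  count f m + fromBool (f m)               ∎
  where open ≡-Reasoning

count-periodic : ∀ m {f : ℕ → Bool} → (∀ i → f (2 + i) ≡ f i) → count f (2 * m) ≡ m * count f 2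
count-periodic zero    f-periodic = refl
count-periodic (suc m) {f} f-periodic = begin
  count f (2 * suc m)                          ≡⟨ cong (count f) (*-suc 2 m) ⟩
  count f (2 + 2 * m)                          ≡⟨ count-+ 2 (2 * m) f ⟩
  count f 2 + count (λ i → f (2 + i)) (2 * m)  ≡⟨ cong (count f 2 +_) (count-cong (2 * m) (λ i _ → f-periodic i)) ⟩
  count f 2 + count f (2 * m)                  ≡⟨ cong (count f 2 +_) (count-periodic m f-periodic) ⟩
  count f 2 + m * count f 2                    ∎
  where open ≡-Reasoning

even-2+ : ∀ i → even (2 + i) ≡ even i
even-2+ i = not-involutive (even i)

odd-2+ : ∀ i → odd (2 + i) ≡ odd i
odd-2+ i = cong not (even-2+ i)

even-double+ : ∀ m a → even (2 * m + a) ≡ even a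
even-double+ zero    a = refl
even-double+ (suc m) a = begin
  even (2 * suc m + a)  ≡⟨ cong (λ v → even (v + a)) (*-suc 2 m) ⟩
  even (2 + 2 * m + a)  ≡⟨ even-2+ (2 * m + a) ⟩
  even (2 * m + a)      ≡⟨ even-double+ m a ⟩
  even a                ∎
  where open ≡-Reasoning

even-double : ∀ m → even (2 * m) ≡ true
even-double m = trans (cong even (sym (+-identityʳ (2 * m)))) (even-double+ m 0)

count-even-double : ∀ m → count even (2 * m) ≡ m
count-even-double m = trans (count-periodic m even-2+) (*-identityʳ m)

count-odd-double : ∀ m → count odd (2 * m) ≡ m
count-odd-double m = trans (count-periodic m odd-2+) (*-identityʳ m)

even-1+double : ∀ m → even (1 + 2 * m) ≡ false
even-1+double m = cong not (even-double m)

even-2+double : ∀ m → even (2 + 2 * m) ≡ true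
even-2+double m = trans (even-2+ (2 * m)) (even-double m)

count-even-double+1 : ∀ m → count even (suc (2 * m)) ≡ suc m
count-even-double+1 m = begin
  count even (suc (2 * m))                       ≡⟨ count-snoc (2 * m) even ⟩
  count even (2 * m) + fromBool (even (2 * m))   ≡⟨ cong₂ _+_ (count-even-double m) (cong fromBool (even-double m)) ⟩
  m + 1                                          ≡⟨ +-comm m 1 ⟩
  suc m                                          ∎
  where open ≡-Reasoning

count-even-3+double : ∀ m → count even (3 + 2 * m) ≡ 2 + m
count-even-3+double m = trans (cong (λ l → count even (suc l)) (sym (*-suc 2 m))) (count-even-double+1 (suc m))

onℕ : (N : ℕ) → (ℕ → ℕ → Bool) → Tournament (suc N)
arc (onℕ N A) x y = A (toℕ x) (toℕ y)

record IsSoleOut (N : ℕ) (A : ℕ → ℕ → Bool) (i j : ℕ) : Set where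
  field
    source≤ : i ≤ N
    target≤ : j ≤ N
    arc-to  : A i j ≡ true
    unique  : ∀ {b} → b ≤ N → A i b ≡ true → b ≡ j
open IsSoleOut

two-outs⇒¬isSoleOut : ∀ {N A i b b′} → b < b′ → b′ ≤ N → A i b ≡ true → A i b′ ≡ true →
  ∀ {j} → ¬ IsSoleOut N A i j
two-outs⇒¬isSoleOut b<b′ b′≤N i→b i→b′ s =
  <⇒≢ b<b′ (trans (unique s (≤-trans (<⇒≤ b<b′) b′≤N) i→b) (sym (unique s b′≤N i→b′)))

isSoleOut⇒count≡1 : ∀ {N A i j} → IsSoleOut N A i j → count (A i) (suc N) ≡ 1
isSoleOut⇒count≡1 s = count-unique _ (s≤s (target≤ s)) (arc-to s) (λ b b<N → unique s (≤-pred b<N))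

module _ {N : ℕ} {A : ℕ → ℕ → Bool} where

  soleOut⇒isSoleOut : ∀ {x y} → SoleOut (onℕ N A) x y → IsSoleOut N A (toℕ x) (toℕ y)
  soleOut⇒isSoleOut {x} {y} (x→y , only-y) = record
    { source≤ = ≤-pred (toℕ<n x)
    ; target≤ = ≤-pred (toℕ<n y)
    ; arc-to  = x→y
    ; unique  = λ b≤N x→b → trans (sym (toℕ-fromℕ< (s≤s b≤N)))
        (cong toℕ (only-y _ (trans (cong (A (toℕ x)) (toℕ-fromℕ< (s≤s b≤N))) x→b)))
    }

  isSoleOut⇒soleOut : ∀ {i j} (s : IsSoleOut N A i j) →
    SoleOut (onℕ N A) (fromℕ< (s≤s (source≤ s))) (fromℕ< (s≤s (target≤ s)))
  isSoleOut⇒soleOut s =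
    trans (cong₂ A (toℕ-fromℕ< (s≤s (source≤ s))) (toℕ-fromℕ< (s≤s (target≤ s)))) (arc-to s) ,
    λ z x→z → toℕ-injective (trans
      (unique s (≤-pred (toℕ<n z))
        (trans (cong (λ v → A v (toℕ z)) (sym (toℕ-fromℕ< (s≤s (source≤ s))))) x→z))
      (sym (toℕ-fromℕ< (s≤s (target≤ s)))))

  outdeg-onℕ : ∀ x → outdeg (onℕ N A) x ≡ count (A (toℕ x)) (suc N)
  outdeg-onℕ x = sum≡count {suc N} (A (toℕ x))
    where
    sum≡count : ∀ {m} (f : ℕ → Bool) → sum {m} (λ y → fromBool (f (toℕ y))) ≡ count f m
    sum≡count {zero}  f = refl
    sum≡count {suc m} f = cong (fromBool (f 0) +_) (sum≡count {m} (λ i → f (suc i)))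

  chain-onℕ : ∀ {i j l} → IsSoleOut N A i j → IsSoleOut N A j l → SoleOutChain (onℕ N A)
  chain-onℕ i→j j→l = _ , _ , _ , isSoleOut⇒soleOut i→j , isSoleOut⇒soleOut j→l

  degree-onℕ : ∀ {i j} → IsSoleOut N A i j → SoleOutDegree (onℕ N A) (count (A j) (suc N))
  degree-onℕ s = _ , _ , isSoleOut⇒soleOut s ,
    trans (outdeg-onℕ _) (cong (λ v → count (A v) (suc N)) (toℕ-fromℕ< (s≤s (target≤ s))))

  soleOutChain-onℕ : SoleOutChain (onℕ N A) →
    ∃ λ i → ∃ λ j → ∃ λ l → IsSoleOut N A i j × IsSoleOut N A j l
  soleOutChain-onℕ (_ , _ , _ , x→y , y→z) = _ , _ , _ , soleOut⇒isSoleOut x→y , soleOut⇒isSoleOut y→z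

  soleOutDegree-onℕ : ∀ {d} → SoleOutDegree (onℕ N A) d →
    ∃ λ i → ∃ λ j → IsSoleOut N A i j × d ≡ count (A j) (suc N)
  soleOutDegree-onℕ (_ , y , x→y , deg) = _ , _ , soleOut⇒isSoleOut x→y , trans (sym deg) (outdeg-onℕ y)

record Signature : Set₁ where
  constructor signature
  field
    hasChain      : Bool
    witnessDegree : ℕ
    Admissible    : ℕ → Set
open Signature

record Side {m} (T : Tournament m) (σ : Signature) : Set where
  field
    chain?     : Reflects (SoleOutChain T) (hasChain σ)
    witness    : SoleOutDegree T (witnessDegree σ)
    admissible : ∀ {d} → SoleOutDegree T d → Admissible σ d
open Side

side-≅ : ∀ {m} {T T′ : Tournament m} {σ} → T ≅ T′ → Side T σ → Side T′ σ
side-≅ iso S = record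
  { chain?     = transport (chain? S)
  ; witness    = soleOutDegree-≅ iso (witness S)
  ; admissible = λ deg → admissible S (soleOutDegree-≅ (≅-sym iso) deg)
  }
  where
  transport : ∀ {b} → Reflects (SoleOutChain _) b → Reflects (SoleOutChain _) b
  transport (ofʸ ch)  = ofʸ (soleOutChain-≅ iso ch)
  transport (ofⁿ ¬ch) = ofⁿ (λ ch → ¬ch (soleOutChain-≅ (≅-sym iso) ch))

Agree : Signature → Signature → Set
Agree σ σ′ = hasChain σ ≡ hasChain σ′ × Admissible σ′ (witnessDegree σ)

sides-agree : ∀ {m} {T : Tournament m} {σ σ′} → Side T σ → Side T σ′ → Agree σ σ′
sides-agree S S′ = det (chain? S) (chain? S′) , admissible S′ (witness S)

uniqueSoleOut-side : ∀ {N A a b d} → IsSoleOut N A a b →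
  (∀ {i j} → IsSoleOut N A i j → i ≡ a × j ≡ b) → a ≢ b → count (A b) (suc N) ≡ d →
  Side (onℕ N A) (signature false d (_≡ d))
uniqueSoleOut-side {N} {A} s only a≢b count≡d = record
  { chain?     = ofⁿ λ ch → let (_ , _ , _ , i→j , j→l) = soleOutChain-onℕ ch in
                   a≢b (trans (sym (proj₁ (only j→l))) (proj₂ (only i→j)))
  ; witness    = subst (SoleOutDegree (onℕ N A)) count≡d (degree-onℕ s)
  ; admissible = λ deg → let (_ , _ , i→j , d≡) = soleOutDegree-onℕ deg in
                   trans d≡ (trans (cong (λ v → count (A v) (suc N)) (proj₂ (only i→j))) count≡d)
  }

<ᵇ-true : ∀ {m n} → m < n → (m <ᵇ n) ≡ true
<ᵇ-true {zero}  (s≤s _)   = refl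
<ᵇ-true {suc m} (s≤s m<n) = <ᵇ-true m<n

<ᵇ-false : ∀ {m n} → n ≤ m → (m <ᵇ n) ≡ false
<ᵇ-false {zero}  z≤n       = refl
<ᵇ-false {suc m} z≤n       = refl
<ᵇ-false         (s≤s n≤m) = <ᵇ-false n≤m

≤ᵇ-true : ∀ {m n} → m ≤ n → (m ≤ᵇ n) ≡ true
≤ᵇ-true z≤n         = refl
≤ᵇ-true m≤n@(s≤s _) = <ᵇ-true m≤n

≤ᵇ-false : ∀ {m n} → n < m → (m ≤ᵇ n) ≡ false
≤ᵇ-false {suc m} (s≤s n≤m) = <ᵇ-false n≤m

≡ᵇ-refl : ∀ m → (m ≡ᵇ m) ≡ true
≡ᵇ-refl zero    = refl
≡ᵇ-refl (suc m) = ≡ᵇ-refl m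

≡ᵇ-false : ∀ {m n} → ¬ m ≡ n → (m ≡ᵇ n) ≡ false
≡ᵇ-false {zero}  {zero}  m≢n = ⊥-elim (m≢n refl)
≡ᵇ-false {zero}  {suc n} m≢n = refl
≡ᵇ-false {suc m} {zero}  m≢n = refl
≡ᵇ-false {suc m} {suc n} m≢n = ≡ᵇ-false (λ m≡n → m≢n (cong suc m≡n))

absurd-arc : ∀ {b} {C : Set} → b ≡ true → b ≡ false → C
absurd-arc refl ()

module _ (f : ℕ → ℕ → Bool) where

  fromFwd-< : ∀ {i j} → i < j → fromFwd f i j ≡ f i j
  fromFwd-< i<j rewrite <ᵇ-true i<j = refl

  fromFwd-> : ∀ {i j} → j < i → fromFwd f i j ≡ not (f j i)
  fromFwd-> j<i rewrite <ᵇ-false (<⇒≤ j<i) | <ᵇ-true j<i = refl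

  fromFwd-irrefl : ∀ i → fromFwd f i i ≡ false
  fromFwd-irrefl i rewrite <ᵇ-false (≤-refl {i}) = refl

q : ℕ → ℕ → ℕ
q k a = suc (suc (2 * k + a))

centre<q : ∀ k a → suc (2 * k) < q k a
centre<q k a = s≤s (s≤s (m≤m+n (2 * k) a))

P<q : ∀ k {i} a → i ≤ 2 * k → i < q k a
P<q k a i≤2k = <-trans (s≤s i≤2k) (centre<q k a)

q-mono-< : ∀ k {a b} → a < b → q k a < q k b
q-mono-< k a<b = s≤s (s≤s (+-monoʳ-< (2 * k) a<b))

q-mono-≤ : ∀ k {a b} → a ≤ b → q k a ≤ q k b
q-mono-≤ k a≤b = s≤s (s≤s (+-monoʳ-≤ (2 * k) a≤b))

q-cancel-≤ : ∀ k {a b} → q k a ≤ q k b → a ≤ b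
q-cancel-≤ k (s≤s (s≤s le)) = +-cancelˡ-≤ (2 * k) _ _ le

even-q : ∀ k a → even (q k a) ≡ even a
even-q k a = trans (even-2+ (2 * k + a)) (even-double+ k a)

module Layout (k : ℕ) (pP cr qQ : ℕ → ℕ → Bool) where

  private
    fwd : ℕ → ℕ → Bool
    fwd = fwdGen 0 k pP cr qQ

    q≰2k : ∀ a → (q k a ≤ᵇ 2 * k) ≡ false
    q≰2k a = ≤ᵇ-false (P<q k a ≤-refl)

    q≢centre : ∀ a → (q k a ≡ᵇ suc (2 * k)) ≡ false
    q≢centre a = ≡ᵇ-false (λ e → <-irrefl (sym e) (centre<q k a))

    fwd-P-P : ∀ {i j} → j ≤ 2 * k → fwd i j ≡ pP i j
    fwd-P-P j≤2k rewrite ≤ᵇ-true j≤2k = refl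

    fwd-centre : ∀ i → fwd i (suc (2 * k)) ≡ true
    fwd-centre i rewrite ≤ᵇ-false (≤-refl {suc (2 * k)}) | ≡ᵇ-refl (2 * k) = refl

    fwd-P-Q : ∀ {i} a → i ≤ 2 * k → fwd i (q k a) ≡ cr i (q k a)
    fwd-P-Q a i≤2k rewrite q≰2k a | q≢centre a | ≤ᵇ-true i≤2k = refl

    fwd-centre-Q : ∀ a → fwd (suc (2 * k)) (q k a) ≡ true
    fwd-centre-Q a
      rewrite q≰2k a | q≢centre a | ≤ᵇ-false (≤-refl {suc (2 * k)}) | ≡ᵇ-refl (2 * k) = refl

    fwd-Q-Q : ∀ a b → fwd (q k a) (q k b) ≡ qQ (q k a) (q k b)
    fwd-Q-Q a b rewrite q≰2k b | q≢centre b | q≰2k a | q≢centre a = refl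

  A : ℕ → ℕ → Bool
  A = fromFwd fwd

  arc-irrefl : ∀ i → A i i ≡ false
  arc-irrefl = fromFwd-irrefl fwd

  arc-P-P : ∀ {i j} → i < j → j ≤ 2 * k → A i j ≡ pP i j
  arc-P-P i<j j≤2k = trans (fromFwd-< fwd i<j) (fwd-P-P j≤2k)

  arc-P-P′ : ∀ {i j} → i < j → j ≤ 2 * k → A j i ≡ not (pP i j)
  arc-P-P′ i<j j≤2k = trans (fromFwd-> fwd i<j) (cong not (fwd-P-P j≤2k))

  arc-P-centre : ∀ {i} → i ≤ 2 * k → A i (suc (2 * k)) ≡ true
  arc-P-centre i≤2k = trans (fromFwd-< fwd (s≤s i≤2k)) (fwd-centre _)

  arc-centre-P : ∀ {i} → i ≤ 2 * k → A (suc (2 * k)) i ≡ false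
  arc-centre-P i≤2k = trans (fromFwd-> fwd (s≤s i≤2k)) (cong not (fwd-centre _))

  arc-P-Q : ∀ {i} a → i ≤ 2 * k → A i (q k a) ≡ cr i (q k a)
  arc-P-Q a i≤2k = trans (fromFwd-< fwd (P<q k a i≤2k)) (fwd-P-Q a i≤2k)

  arc-Q-P : ∀ {i} a → i ≤ 2 * k → A (q k a) i ≡ not (cr i (q k a))
  arc-Q-P a i≤2k = trans (fromFwd-> fwd (P<q k a i≤2k)) (cong not (fwd-P-Q a i≤2k))

  arc-centre-Q : ∀ a → A (suc (2 * k)) (q k a) ≡ true
  arc-centre-Q a = trans (fromFwd-< fwd (centre<q k a)) (fwd-centre-Q a)

  arc-Q-centre : ∀ a → A (q k a) (suc (2 * k)) ≡ false
  arc-Q-centre a = trans (fromFwd-> fwd (centre<q k a)) (cong not (fwd-centre-Q a))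

  arc-Q-Q : ∀ {a b} → a < b → A (q k a) (q k b) ≡ qQ (q k a) (q k b)
  arc-Q-Q {a} {b} a<b = trans (fromFwd-< fwd (q-mono-< k a<b)) (fwd-Q-Q a b)

  arc-Q-Q′ : ∀ {a b} → a < b → A (q k b) (q k a) ≡ not (qQ (q k a) (q k b))
  arc-Q-Q′ {a} {b} a<b = trans (fromFwd-> fwd (q-mono-< k a<b)) (cong not (fwd-Q-Q a b))

-- For n = k + r + 2: P = {0, …, 2k}, the centre is 2k+1, Q = {q k a | a ≤ 2 + 2r} and top = 2n.
module Shape (k r : ℕ) where

  top top-1 top-2 : ℕ
  top   = q k (2 + 2 * r)
  top-1 = q k (1 + 2 * r)
  top-2 = q k (2 * r)

  data Region : ℕ → Set where
    inP      : ∀ {i} → i ≤ 2 * k → Region i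
    isCentre : Region (suc (2 * k))
    inQ      : ∀ {a} → a ≤ 2 + 2 * r → Region (q k a)

  region : ∀ {i} → i ≤ top → Region i
  region {i} i≤top with <-cmp i (suc (2 * k))
  ... | tri< i<c _ _ = inP (≤-pred i<c)
  ... | tri≈ _ refl _ = isCentre
  ... | tri> _ _ c<i with i ∸ suc (suc (2 * k)) | m+[n∸m]≡n c<i
  ...   | a | refl = inQ (q-cancel-≤ k i≤top)

  data QIndex : ℕ → Set where
    belowTop-2 : ∀ {a} → a < 2 * r → QIndex a
    atTop-2    : QIndex (2 * r)
    atTop-1    : QIndex (1 + 2 * r)
    atTop      : QIndex (2 + 2 * r)

  qIndex : ∀ {a} → a ≤ 2 + 2 * r → QIndex a
  qIndex a≤ with m≤n⇒m<n∨m≡n a≤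
  ... | inj₂ refl = atTop
  ... | inj₁ (s≤s a≤) with m≤n⇒m<n∨m≡n a≤
  ...   | inj₂ refl = atTop-1
  ...   | inj₁ (s≤s a≤) with m≤n⇒m<n∨m≡n a≤
  ...     | inj₁ a<2r = belowTop-2 a<2r
  ...     | inj₂ refl = atTop-2

  q≢top : ∀ {a} → a ≤ 1 + 2 * r → (q k a ≡ᵇ top) ≡ false
  q≢top a≤ = ≡ᵇ-false (<⇒≢ (q-mono-< k (s≤s a≤)))

  q≤top : ∀ {a} → a ≤ 2 + 2 * r → q k a ≤ top
  q≤top = q-mono-≤ k

  centre≤top : suc (2 * k) ≤ top
  centre≤top = <⇒≤ (centre<q k _)

  P≤top : ∀ {i} → i ≤ 2 * k → i ≤ top
  P≤top i≤2k = <⇒≤ (P<q k _ i≤2k)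

  count-layout : ∀ f → count f (suc top) ≡
    count f (suc (2 * k)) + fromBool (f (suc (2 * k))) + count (λ a → f (q k a)) (3 + 2 * r)
  count-layout f = begin
    count f (suc top)
      ≡⟨ cong (λ m → count f (suc (suc m))) (+-suc (2 * k) (2 + 2 * r)) ⟨
    count f (2 + 2 * k + (3 + 2 * r))
      ≡⟨ count-+ (2 + 2 * k) (3 + 2 * r) f ⟩
    count f (2 + 2 * k) + count (λ a → f (q k a)) (3 + 2 * r)
      ≡⟨ cong (_+ count (λ a → f (q k a)) (3 + 2 * r)) (count-snoc (suc (2 * k)) f) ⟩
    count f (suc (2 * k)) + fromBool (f (suc (2 * k))) + count (λ a → f (q k a)) (3 + 2 * r) ∎
    where open ≡-Reasoning

module EF-Analysis (k r : ℕ) (1≤k : 1 ≤ k) (pP : ℕ → ℕ → Bool)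
          (pP-1 : ∀ j → pP 1 j ≡ true) (pP-0 : ∀ j → pP 0 j ≡ true ⊎ even j ≡ true) where

  open Shape k r
  open Layout k pP crossEF fwdTrans public

  private
    1≤2k : 1 ≤ 2 * k
    1≤2k = <⇒≤ (*-monoʳ-≤ 2 1≤k)

  arc-Q-P-EF : ∀ {i} a → i ≤ 2 * k → A (q k a) i ≡ even i ∧ even a
  arc-Q-P-EF {i} a i≤ = trans (arc-Q-P a i≤) (trans (not-involutive _) (cong (even i ∧_) (even-q k a)))

  arc-top-P : ∀ {i} → i ≤ 2 * k → A top i ≡ even i
  arc-top-P {i} i≤ = trans (arc-Q-P-EF _ i≤) (trans (cong (even i ∧_) (even-2+double r)) (∧-identityʳ _))

  arc-top-1-P : ∀ {i} → i ≤ 2 * k → A top-1 i ≡ false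
  arc-top-1-P {i} i≤ = trans (arc-Q-P-EF _ i≤) (trans (cong (even i ∧_) (even-1+double r)) (∧-zeroʳ _))

  arc-P-top-1 : ∀ {i} → i ≤ 2 * k → A i top-1 ≡ true
  arc-P-top-1 {i} i≤ = trans (arc-P-Q _ i≤)
    (cong not (trans (cong (even i ∧_) (trans (even-q k _) (even-1+double r))) (∧-zeroʳ _)))

  soleOut-EF : ∀ {i j} → IsSoleOut top A i j → i ≡ top-1 × j ≡ top
  soleOut-EF s = go (region (source≤ s)) s
    where
    Q-before-top-1 : ∀ {a j} → a < 1 + 2 * r → ¬ IsSoleOut top A (q k a) j
    Q-before-top-1 a< = two-outs⇒¬isSoleOut (q-mono-< k (n<1+n _)) ≤-refl (arc-Q-Q a<) (arc-Q-Q (m<n⇒m<1+n a<))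

    go : ∀ {i j} → Region i → IsSoleOut top A i j → i ≡ top-1 × j ≡ top
    go (inP i≤) = ⊥-elim ∘ two-outs⇒¬isSoleOut (centre<q k _) (q≤top (n≤1+n _))
                    (arc-P-centre i≤) (arc-P-top-1 i≤)
    go isCentre = ⊥-elim ∘ two-outs⇒¬isSoleOut (q-mono-< k (n<1+n _)) ≤-refl
                    (arc-centre-Q _) (arc-centre-Q _)
    go (inQ a≤) with qIndex a≤
    ... | belowTop-2 a< = ⊥-elim ∘ Q-before-top-1 (m<n⇒m<1+n a<)
    ... | atTop-2 = ⊥-elim ∘ Q-before-top-1 (n<1+n _)
    ... | atTop-1 = λ s → refl , sym (unique s ≤-refl (arc-Q-Q (n<1+n _)))
    ... | atTop = ⊥-elim ∘ two-outs⇒¬isSoleOut 1≤2k (P≤top ≤-refl)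
                    (arc-top-P z≤n) (trans (arc-top-P ≤-refl) (even-double k))

  top-1→top : IsSoleOut top A top-1 top
  top-1→top = record
    { source≤ = q≤top (n≤1+n _) ; target≤ = ≤-refl ; arc-to = arc-Q-Q (n<1+n _) ; unique = only }
    where
    only : ∀ {b} → b ≤ top → A top-1 b ≡ true → b ≡ top
    only b≤ h with region b≤
    ... | inP i≤ = absurd-arc h (arc-top-1-P i≤)
    ... | isCentre = absurd-arc h (arc-Q-centre _)
    ... | inQ a≤ with qIndex a≤
    ...   | belowTop-2 a< = absurd-arc h (arc-Q-Q′ (m<n⇒m<1+n a<))
    ...   | atTop-2 = absurd-arc h (arc-Q-Q′ (n<1+n _))
    ...   | atTop-1 = absurd-arc h (arc-irrefl top-1)
    ...   | atTop = refl

  count-top : count (A top) (suc top) ≡ suc k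
  count-top = begin
    count (A top) (suc top)
      ≡⟨ count-layout (A top) ⟩
    count (A top) (suc (2 * k)) + fromBool (A top (suc (2 * k))) + count (λ a → A top (q k a)) (3 + 2 * r)
      ≡⟨ cong₂ _+_ (cong₂ _+_ P-part (cong fromBool (arc-Q-centre _))) Q-part ⟩
    suc k + 0 + 0
      ≡⟨ +-identityʳ _ ⟩
    suc k + 0
      ≡⟨ +-identityʳ _ ⟩
    suc k ∎
    where
    open ≡-Reasoning
    P-part : count (A top) (suc (2 * k)) ≡ suc k
    P-part = trans (count-cong _ (λ i i< → arc-top-P (≤-pred i<))) (count-even-double+1 k)
    Q-part : count (λ a → A top (q k a)) (3 + 2 * r) ≡ 0
    Q-part = count-none _ λ a a< →
      [ arc-Q-Q′ , (λ { refl → arc-irrefl top }) ]′ (m≤n⇒m<n∨m≡n (≤-pred a<))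

  pP-0-1 : pP 0 1 ≡ true
  pP-0-1 with pP-0 1
  ... | inj₁ 0→1 = 0→1
  ... | inj₂ ()

  soleIn-EF : ∀ {i j} → IsSoleOut top (flip A) i j → i ≡ 1 × j ≡ 0
  soleIn-EF s = go (region (source≤ s)) s
    where
    go : ∀ {i j} → Region i → IsSoleOut top (flip A) i j → i ≡ 1 × j ≡ 0
    go (inP i≤) = P-case _ i≤
      where
      P-case : ∀ i {j} → i ≤ 2 * k → IsSoleOut top (flip A) i j → i ≡ 1 × j ≡ 0
      P-case zero _ =
        ⊥-elim ∘ two-outs⇒¬isSoleOut (q-mono-< k z<s) ≤-refl (arc-Q-P-EF 0 z≤n) (arc-top-P z≤n)
      P-case 1 i≤ = λ s → refl , sym (unique s z≤n (trans (arc-P-P z<s i≤) pP-0-1))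
      P-case (suc (suc i)) i≤ with pP-0 (2 + i)
      ... | inj₁ 0→i = ⊥-elim ∘ two-outs⇒¬isSoleOut z<s (P≤top 1≤2k)
                         (trans (arc-P-P z<s i≤) 0→i) (trans (arc-P-P (s≤s z<s) i≤) (pP-1 _))
      ... | inj₂ even-i = ⊥-elim ∘ two-outs⇒¬isSoleOut (P<q k 0 1≤2k) (q≤top z≤n)
                            (trans (arc-P-P (s≤s z<s) i≤) (pP-1 _))
                            (trans (arc-Q-P-EF 0 i≤) (trans (∧-identityʳ _) even-i))
    go isCentre = ⊥-elim ∘ two-outs⇒¬isSoleOut z<s (P≤top 1≤2k) (arc-P-centre z≤n) (arc-P-centre 1≤2k)
    go (inQ {a} _) = ⊥-elim ∘ two-outs⇒¬isSoleOut (s≤s 1≤2k) centre≤top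
                       (arc-P-Q a 1≤2k) (arc-centre-Q a)

  1⇐0 : IsSoleOut top (flip A) 1 0
  1⇐0 = record
    { source≤ = P≤top 1≤2k ; target≤ = z≤n ; arc-to = trans (arc-P-P z<s 1≤2k) pP-0-1 ; unique = only }
    where
    only : ∀ {b} → b ≤ top → A b 1 ≡ true → b ≡ 0
    only b≤ h with region b≤
    ... | inP i≤ = P-case _ i≤ h
      where
      P-case : ∀ i → i ≤ 2 * k → A i 1 ≡ true → i ≡ 0
      P-case zero          _  _ = refl
      P-case 1             _  h = absurd-arc h (arc-irrefl 1)
      P-case (suc (suc i)) i≤ h = absurd-arc h (trans (arc-P-P′ (s≤s z<s) i≤) (cong not (pP-1 _)))
    ... | isCentre = absurd-arc h (arc-centre-P 1≤2k)
    ... | inQ {a} _ = absurd-arc h (arc-Q-P a 1≤2k)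

  count-into-0 : count (flip A 0) (suc top) ≡ count (λ j → not (pP 0 (suc j))) (2 * k) + (2 + r)
  count-into-0 = begin
    count (flip A 0) (suc top)
      ≡⟨ count-layout (flip A 0) ⟩
    count (flip A 0) (suc (2 * k)) + fromBool (A (suc (2 * k)) 0) + count (λ a → A (q k a) 0) (3 + 2 * r)
      ≡⟨ cong₂ _+_ (cong₂ _+_ P-part (cong fromBool (arc-centre-P z≤n))) Q-part ⟩
    count (λ j → not (pP 0 (suc j))) (2 * k) + 0 + (2 + r)
      ≡⟨ cong (_+ (2 + r)) (+-identityʳ _) ⟩
    count (λ j → not (pP 0 (suc j))) (2 * k) + (2 + r) ∎
    where
    open ≡-Reasoning
    P-part : count (flip A 0) (suc (2 * k)) ≡ count (λ j → not (pP 0 (suc j))) (2 * k)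
    P-part = cong₂ _+_ (cong fromBool (arc-irrefl 0)) (count-cong (2 * k) (λ j j< → arc-P-P′ z<s j<))
    Q-part : count (λ a → A (q k a) 0) (3 + 2 * r) ≡ 2 + r
    Q-part = trans (count-cong (3 + 2 * r) (λ a _ → arc-Q-P-EF a z≤n)) (count-even-3+double r)

  outSide : Side (onℕ top A) (signature false (suc k) (_≡ suc k))
  outSide = uniqueSoleOut-side top-1→top soleOut-EF (<⇒≢ (q-mono-< k (n<1+n _))) count-top

  inSide : ∀ {d} → count (λ j → not (pP 0 (suc j))) (2 * k) + (2 + r) ≡ d →
    Side (onℕ top (flip A)) (signature false d (_≡ d))
  inSide count≡d = uniqueSoleOut-side 1⇐0 soleIn-EF (λ ()) (trans count-into-0 count≡d)

module GH-Analysis (k r : ℕ) (pP cr : ℕ → ℕ → Bool)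
          (cr-Q : ∀ i a → a ≤ 1 + 2 * r → cr i (q k a) ≡ true) where

  open Shape k r
  open Layout k pP cr (λ i j → if j ≡ᵇ top then odd i else true) public

  arc-Q-Q-GH : ∀ {a b} → a < b → b ≤ 1 + 2 * r → A (q k a) (q k b) ≡ true
  arc-Q-Q-GH {a} a<b b≤ = trans (arc-Q-Q a<b) (cong (if_then odd (q k a) else true) (q≢top b≤))

  arc-Q-Q′-GH : ∀ {a b} → a < b → b ≤ 1 + 2 * r → A (q k b) (q k a) ≡ false
  arc-Q-Q′-GH {a} a<b b≤ =
    trans (arc-Q-Q′ a<b) (cong (λ t → not (if t then odd (q k a) else true)) (q≢top b≤))

  arc-Q-top : ∀ {a} → a < 2 + 2 * r → A (q k a) top ≡ not (even a)
  arc-Q-top {a} a< = trans (arc-Q-Q a<)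
    (trans (cong (if_then odd (q k a) else true) (≡ᵇ-refl top)) (cong not (even-q k a)))

  arc-top-Q : ∀ {a} → a < 2 + 2 * r → A top (q k a) ≡ even a
  arc-top-Q {a} a< = trans (arc-Q-Q′ a<)
    (trans (cong (λ t → not (if t then odd (q k a) else true)) (≡ᵇ-refl top))
           (trans (not-involutive _) (even-q k a)))

  arc-P-Q-GH : ∀ {i a} → i ≤ 2 * k → a ≤ 1 + 2 * r → A i (q k a) ≡ true
  arc-P-Q-GH {i} {a} i≤ a≤ = trans (arc-P-Q a i≤) (cr-Q i a a≤)

  arc-Q-P-GH : ∀ {i a} → i ≤ 2 * k → a ≤ 1 + 2 * r → A (q k a) i ≡ false
  arc-Q-P-GH {i} {a} i≤ a≤ = trans (arc-Q-P a i≤) (cong not (cr-Q i a a≤))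

  top-2→top-1 : IsSoleOut top A top-2 top-1
  top-2→top-1 = record
    { source≤ = q≤top (≤-trans (n≤1+n _) (n≤1+n _)) ; target≤ = q≤top (n≤1+n _)
    ; arc-to = arc-Q-Q-GH (n<1+n _) ≤-refl ; unique = only }
    where
    only : ∀ {b} → b ≤ top → A top-2 b ≡ true → b ≡ top-1
    only b≤ h with region b≤
    ... | inP i≤ = absurd-arc h (arc-Q-P-GH i≤ (n≤1+n _))
    ... | isCentre = absurd-arc h (arc-Q-centre _)
    ... | inQ a≤ with qIndex a≤
    ...   | belowTop-2 a< = absurd-arc h (arc-Q-Q′-GH a< (n≤1+n _))
    ...   | atTop-2 = absurd-arc h (arc-irrefl top-2)
    ...   | atTop-1 = refl
    ...   | atTop = absurd-arc h (trans (arc-Q-top (m<n⇒m<1+n (n<1+n _))) (cong not (even-double r)))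

  top-1→top : IsSoleOut top A top-1 top
  top-1→top = record
    { source≤ = q≤top (n≤1+n _) ; target≤ = ≤-refl
    ; arc-to = trans (arc-Q-top (n<1+n _)) (cong not (even-1+double r)) ; unique = only }
    where
    only : ∀ {b} → b ≤ top → A top-1 b ≡ true → b ≡ top
    only b≤ h with region b≤
    ... | inP i≤ = absurd-arc h (arc-Q-P-GH i≤ ≤-refl)
    ... | isCentre = absurd-arc h (arc-Q-centre _)
    ... | inQ a≤ with qIndex a≤
    ...   | belowTop-2 a< = absurd-arc h (arc-Q-Q′-GH (m<n⇒m<1+n a<) ≤-refl)
    ...   | atTop-2 = absurd-arc h (arc-Q-Q′-GH (n<1+n _) ≤-refl)
    ...   | atTop-1 = absurd-arc h (arc-irrefl top-1)
    ...   | atTop = refl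

  soleOut-GH : (∀ {j} → ¬ IsSoleOut top A top j) →
    ∀ {i j} → IsSoleOut top A i j → (i ≡ top-2 × j ≡ top-1) ⊎ (i ≡ top-1 × j ≡ top)
  soleOut-GH top-not-sole s = go (region (source≤ s)) s
    where
    go : ∀ {i j} → Region i → IsSoleOut top A i j →
      (i ≡ top-2 × j ≡ top-1) ⊎ (i ≡ top-1 × j ≡ top)
    go (inP i≤) = ⊥-elim ∘ two-outs⇒¬isSoleOut (centre<q k _) (q≤top (n≤1+n _))
                    (arc-P-centre i≤) (arc-P-Q-GH i≤ ≤-refl)
    go isCentre = ⊥-elim ∘ two-outs⇒¬isSoleOut (q-mono-< k (n<1+n _)) ≤-refl
                    (arc-centre-Q _) (arc-centre-Q _)
    go (inQ a≤) with qIndex a≤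
    ... | belowTop-2 a< = ⊥-elim ∘ two-outs⇒¬isSoleOut (q-mono-< k (n<1+n _)) (q≤top (n≤1+n _))
                            (arc-Q-Q-GH a< (n≤1+n _)) (arc-Q-Q-GH (m<n⇒m<1+n a<) ≤-refl)
    ... | atTop-2 = λ s → inj₁ (refl , sym (unique s (target≤ top-2→top-1) (arc-to top-2→top-1)))
    ... | atTop-1 = λ s → inj₂ (refl , sym (unique s ≤-refl (arc-to top-1→top)))
    ... | atTop = ⊥-elim ∘ top-not-sole

module G-Analysis (k r : ℕ) (1≤k : 1 ≤ k) where

  open Shape k r
  open GH-Analysis k r fwdU (λ i j → not ((j ≡ᵇ top) ∧ even i))
          (λ i a a≤ → cong (λ t → not (t ∧ even i)) (q≢top a≤)) public

  private
    1≤2k : 1 ≤ 2 * k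
    1≤2k = <⇒≤ (*-monoʳ-≤ 2 1≤k)

  arc-top-P : ∀ {i} → i ≤ 2 * k → A top i ≡ even i
  arc-top-P {i} i≤ = trans (arc-Q-P _ i≤) (trans (not-involutive _) (cong (_∧ even i) (≡ᵇ-refl top)))

  outSide : Side (onℕ top A) (signature true 1 (λ _ → ⊤))
  outSide = record
    { chain?     = ofʸ (chain-onℕ top-2→top-1 top-1→top)
    ; witness    = subst (SoleOutDegree (onℕ top A)) (isSoleOut⇒count≡1 top-1→top)
                         (degree-onℕ top-2→top-1)
    ; admissible = λ _ → tt
    }

  soleIn-G : ∀ {i j} → IsSoleOut top (flip A) i j → i ≡ 1 × j ≡ 0
  soleIn-G s = go (region (source≤ s)) s
    where
    go : ∀ {i j} → Region i → IsSoleOut top (flip A) i j → i ≡ 1 × j ≡ 0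
    go (inP i≤) = P-case _ i≤
      where
      P-case : ∀ i {j} → i ≤ 2 * k → IsSoleOut top (flip A) i j → i ≡ 1 × j ≡ 0
      P-case zero _ = ⊥-elim ∘ two-outs⇒¬isSoleOut (P<q k _ ≤-refl) ≤-refl
        (trans (arc-P-P′ 1≤2k ≤-refl) (trans (not-involutive _) (even-double k))) (arc-top-P z≤n)
      P-case 1 i≤ = λ s → refl , sym (unique s z≤n (arc-P-P z<s i≤))
      P-case (suc (suc i)) i≤ with even i in even-i
      ... | true  = ⊥-elim ∘ two-outs⇒¬isSoleOut (P<q k _ 1≤2k) ≤-refl
                      (arc-P-P (s≤s z<s) i≤) (trans (arc-top-P i≤) (trans (even-2+ i) even-i))
      ... | false = ⊥-elim ∘ two-outs⇒¬isSoleOut z<s (P≤top 1≤2k)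
                      (trans (arc-P-P z<s i≤) (trans (odd-2+ i) (cong not even-i))) (arc-P-P (s≤s z<s) i≤)
    go isCentre = ⊥-elim ∘ two-outs⇒¬isSoleOut z<s (P≤top 1≤2k) (arc-P-centre z≤n) (arc-P-centre 1≤2k)
    go (inQ {a} _) = ⊥-elim ∘ two-outs⇒¬isSoleOut (s≤s 1≤2k) centre≤top
      (trans (arc-P-Q a 1≤2k) (cong not (∧-zeroʳ _))) (arc-centre-Q a)

  1⇐0 : IsSoleOut top (flip A) 1 0
  1⇐0 = record { source≤ = P≤top 1≤2k ; target≤ = z≤n ; arc-to = arc-P-P z<s 1≤2k ; unique = only }
    where
    only : ∀ {b} → b ≤ top → A b 1 ≡ true → b ≡ 0
    only b≤ h with region b≤
    ... | inP i≤ = P-case _ i≤ h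
      where
      P-case : ∀ i → i ≤ 2 * k → A i 1 ≡ true → i ≡ 0
      P-case zero          _  _ = refl
      P-case 1             _  h = absurd-arc h (arc-irrefl 1)
      P-case (suc (suc i)) i≤ h = absurd-arc h (arc-P-P′ (s≤s z<s) i≤)
    ... | isCentre = absurd-arc h (arc-centre-P 1≤2k)
    ... | inQ {a} _ = absurd-arc h (trans (arc-Q-P a 1≤2k) (trans (not-involutive _) (∧-zeroʳ _)))

  count-into-0 : count (flip A 0) (suc top) ≡ suc k
  count-into-0 = begin
    count (flip A 0) (suc top)
      ≡⟨ count-layout (flip A 0) ⟩
    count (flip A 0) (suc (2 * k)) + fromBool (A (suc (2 * k)) 0) + count (λ a → A (q k a) 0) (3 + 2 * r)
      ≡⟨ cong₂ _+_ (cong₂ _+_ P-part (cong fromBool (arc-centre-P z≤n))) Q-part ⟩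
    k + 0 + 1
      ≡⟨ cong (_+ 1) (+-identityʳ k) ⟩
    k + 1
      ≡⟨ +-comm k 1 ⟩
    suc k ∎
    where
    open ≡-Reasoning
    P-part : count (flip A 0) (suc (2 * k)) ≡ k
    P-part = trans (count-cong (2 * k) (λ j j< → trans (arc-P-P′ z<s j<) (not-involutive _)))
                   (count-odd-double k)
    into-0 : ∀ a → A (q k a) 0 ≡ (q k a ≡ᵇ top)
    into-0 a = trans (arc-Q-P a z≤n) (trans (not-involutive _) (∧-identityʳ _))
    Q-part : count (λ a → A (q k a) 0) (3 + 2 * r) ≡ 1
    Q-part = count-unique (3 + 2 * r) ≤-refl (trans (into-0 _) (≡ᵇ-refl top)) only
      where
      only : ∀ a → a < 3 + 2 * r → A (q k a) 0 ≡ true → a ≡ 2 + 2 * r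
      only a a< h with m≤n⇒m<n∨m≡n (≤-pred a<)
      ... | inj₁ (s≤s a≤) = absurd-arc h (trans (into-0 a) (q≢top a≤))
      ... | inj₂ a≡ = a≡

  inSide : Side (onℕ top (flip A)) (signature false (suc k) (_≡ suc k))
  inSide = uniqueSoleOut-side 1⇐0 soleIn-G (λ ()) count-into-0

module H-Analysis (k r : ℕ) (1≤k : 1 ≤ k) where

  open Shape k r
  open GH-Analysis k r (fwdV k) (λ i j → not ((j ≡ᵇ top) ∧ (i ≡ᵇ 2 * k)))
          (λ i a a≤ → cong (λ t → not (t ∧ (i ≡ᵇ 2 * k))) (q≢top a≤)) public

  private
    1<2k : 1 < 2 * k
    1<2k = *-monoʳ-≤ 2 1≤k

    1≤2k : 1 ≤ 2 * k
    1≤2k = <⇒≤ 1<2k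

  arc-top-P : ∀ {i} → i ≤ 2 * k → A top i ≡ (i ≡ᵇ 2 * k)
  arc-top-P {i} i≤ =
    trans (arc-Q-P _ i≤) (trans (not-involutive _) (cong (_∧ (i ≡ᵇ 2 * k)) (≡ᵇ-refl top)))

  arc-Q-into-P : ∀ {i} a → i < 2 * k → A (q k a) i ≡ false
  arc-Q-into-P {i} a i< = trans (arc-Q-P a (<⇒≤ i<)) (trans (not-involutive _)
    (trans (cong ((q k a ≡ᵇ top) ∧_) (≡ᵇ-false (<⇒≢ i<))) (∧-zeroʳ _)))

  top-not-sole : ∀ {j} → ¬ IsSoleOut top A top j
  top-not-sole = two-outs⇒¬isSoleOut (P<q k 0 ≤-refl) (q≤top z≤n)
    (trans (arc-top-P ≤-refl) (≡ᵇ-refl (2 * k))) (arc-top-Q z<s)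

  count-top : count (A top) (suc top) ≡ 2 + r
  count-top = begin
    count (A top) (suc top)
      ≡⟨ count-layout (A top) ⟩
    count (A top) (suc (2 * k)) + fromBool (A top (suc (2 * k))) + count (λ a → A top (q k a)) (3 + 2 * r)
      ≡⟨ cong₂ _+_ (cong₂ _+_ P-part (cong fromBool (arc-Q-centre _))) Q-part ⟩
    1 + 0 + (suc r + 0)
      ≡⟨ cong (2 +_) (+-identityʳ r) ⟩
    2 + r ∎
    where
    open ≡-Reasoning
    P-part : count (A top) (suc (2 * k)) ≡ 1
    P-part = count-unique (suc (2 * k)) ≤-refl (trans (arc-top-P ≤-refl) (≡ᵇ-refl (2 * k))) only
      where
      only : ∀ i → i < suc (2 * k) → A top i ≡ true → i ≡ 2 * k
      only i i< h with m≤n⇒m<n∨m≡n (≤-pred i<)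
      ... | inj₁ i<2k = absurd-arc h (trans (arc-top-P (<⇒≤ i<2k)) (≡ᵇ-false (<⇒≢ i<2k)))
      ... | inj₂ i≡2k = i≡2k
    Q-part : count (λ a → A top (q k a)) (3 + 2 * r) ≡ suc r + 0
    Q-part = begin
      count (λ a → A top (q k a)) (3 + 2 * r)
        ≡⟨ count-snoc (2 + 2 * r) (λ a → A top (q k a)) ⟩
      count (λ a → A top (q k a)) (2 + 2 * r) + fromBool (A top top)
        ≡⟨ cong₂ _+_ (count-cong (2 + 2 * r) (λ a a< → arc-top-Q a<)) (cong fromBool (arc-irrefl top)) ⟩
      count even (2 + 2 * r) + 0
        ≡⟨ cong (λ m → count even m + 0) (*-suc 2 r) ⟨
      count even (2 * suc r) + 0
        ≡⟨ cong (_+ 0) (count-even-double (suc r)) ⟩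
      suc r + 0 ∎

  outSide : Side (onℕ top A) (signature true (2 + r) (λ d → d ≡ 1 ⊎ d ≡ 2 + r))
  outSide = record
    { chain?     = ofʸ (chain-onℕ top-2→top-1 top-1→top)
    ; witness    = subst (SoleOutDegree (onℕ top A)) count-top (degree-onℕ top-1→top)
    ; admissible = λ deg → target-degree (soleOutDegree-onℕ deg)
    }
    where
    target-degree : ∀ {d} → (∃ λ i → ∃ λ j → IsSoleOut top A i j × d ≡ count (A j) (suc top)) →
      d ≡ 1 ⊎ d ≡ 2 + r
    target-degree (_ , _ , s , d≡) with soleOut-GH top-not-sole s
    ... | inj₁ (_ , refl) = inj₁ (trans d≡ (isSoleOut⇒count≡1 top-1→top))
    ... | inj₂ (_ , refl) = inj₂ (trans d≡ count-top)

  fwdV-1 : ∀ j → fwdV k 1 j ≡ true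
  fwdV-1 j with j ≡ᵇ 2 * k
  ... | true  = refl
  ... | false = refl

  1⇐0 : IsSoleOut top (flip A) 1 0
  1⇐0 = record
    { source≤ = P≤top 1≤2k ; target≤ = z≤n
    ; arc-to = trans (arc-P-P z<s 1≤2k) (cong (if_then odd 0 else true) (≡ᵇ-false (<⇒≢ 1<2k)))
    ; unique = only }
    where
    only : ∀ {b} → b ≤ top → A b 1 ≡ true → b ≡ 0
    only b≤ h with region b≤
    ... | inP i≤ = P-case _ i≤ h
      where
      P-case : ∀ i → i ≤ 2 * k → A i 1 ≡ true → i ≡ 0
      P-case zero          _  _ = refl
      P-case 1             _  h = absurd-arc h (arc-irrefl 1)
      P-case (suc (suc i)) i≤ h = absurd-arc h (trans (arc-P-P′ (s≤s z<s) i≤) (cong not (fwdV-1 (2 + i))))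
    ... | isCentre = absurd-arc h (arc-centre-P 1≤2k)
    ... | inQ {a} _ = absurd-arc h (arc-Q-into-P a 1<2k)

  0⇐2k : IsSoleOut top (flip A) 0 (2 * k)
  0⇐2k = record
    { source≤ = z≤n ; target≤ = P≤top ≤-refl
    ; arc-to = trans (arc-P-P′ 1≤2k ≤-refl)
                     (cong (λ t → not (if t then odd 0 else true)) (≡ᵇ-refl (2 * k)))
    ; unique = only }
    where
    only : ∀ {b} → b ≤ top → A b 0 ≡ true → b ≡ 2 * k
    only b≤ h with region b≤
    ... | inP i≤ = P-case _ i≤ h
      where
      P-case : ∀ i → i ≤ 2 * k → A i 0 ≡ true → i ≡ 2 * k
      P-case zero    _  h = absurd-arc h (arc-irrefl 0)
      P-case (suc i) i≤ h with m≤n⇒m<n∨m≡n i≤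
      ... | inj₁ i<2k = absurd-arc h (trans (arc-P-P′ z<s i≤)
                          (cong (λ t → not (if t then odd 0 else true)) (≡ᵇ-false (<⇒≢ i<2k))))
      ... | inj₂ i≡2k = i≡2k
    ... | isCentre = absurd-arc h (arc-centre-P z≤n)
    ... | inQ {a} _ = absurd-arc h (arc-Q-into-P a 1≤2k)

  inSide : Side (onℕ top (flip A)) (signature true 1 (λ _ → ⊤))
  inSide = record
    { chain?     = ofʸ (chain-onℕ 1⇐0 0⇐2k)
    ; witness    = subst (SoleOutDegree (onℕ top (flip A))) (isSoleOut⇒count≡1 0⇐2k) (degree-onℕ 1⇐0)
    ; admissible = λ _ → tt
    }

outSignature inSignature : Kind → ℕ → ℕ → Signature
outSignature kE  k r = signature false (suc k) (_≡ suc k)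
outSignature kF  k r = signature false (suc k) (_≡ suc k)
outSignature kF* k r = inSignature kF k r
outSignature kG  k r = signature true 1 (λ _ → ⊤)
outSignature kG* k r = inSignature kG k r
outSignature kH  k r = signature true (2 + r) (λ d → d ≡ 1 ⊎ d ≡ 2 + r)
inSignature  kE  k r = signature false (2 + r) (_≡ 2 + r)
inSignature  kF  k r = signature false (2 + (k + r)) (_≡ 2 + (k + r))
inSignature  kF* k r = outSignature kF k r
inSignature  kG  k r = signature false (suc k) (_≡ suc k)
inSignature  kG* k r = outSignature kG k r
inSignature  kH  k r = signature true 1 (λ _ → ⊤)

record Profile {m} (T : Tournament m) (t : Kind) (k r : ℕ) : Set where
  field
    outs : Side T (outSignature t k r)
    ins  : Side (dual T) (inSignature t k r)
open Profile

profile-≅ : ∀ {m} {T T′ : Tournament m} {t k r} → T ≅ T′ → Profile T t k r → Profile T′ t k r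
profile-≅ {T = T} {T′} iso P =
  record { outs = side-≅ iso (outs P) ; ins = side-≅ (dual-≅ {T = T} {T′} iso) (ins P) }

-- family with 2n abstracted to N; fwdGen ignores its first argument, so family t n k is
-- definitionally family′ t k (2 * n), while the analysis above is carried out at N = Shape.top k r.
family′ : Kind → (k N : ℕ) → Tournament (suc N)
family′ kE  k N = onℕ N (fromFwd (fwdGen 0 k fwdTrans crossEF fwdTrans))
family′ kF  k N = onℕ N (fromFwd (fwdGen 0 k fwdU crossEF fwdTrans))
family′ kF* k N = dual (family′ kF k N)
family′ kG  k N = onℕ N (fromFwd (fwdGen 0 k fwdU (λ i j → not ((j ≡ᵇ N) ∧ even i))
                                      (λ i j → if j ≡ᵇ N then odd i else true)))
family′ kG* k N = dual (family′ kG k N)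
family′ kH  k N = onℕ N (fromFwd (fwdGen 0 k (fwdV k) (λ i j → not ((j ≡ᵇ N) ∧ (i ≡ᵇ 2 * k)))
                                      (λ i j → if j ≡ᵇ N then odd i else true)))

family≡family′ : ∀ t n k → family t n k ≡ family′ t k (2 * n)
family≡family′ kE  n k = refl
family≡family′ kF  n k = refl
family≡family′ kF* n k = refl
family≡family′ kG  n k = refl
family≡family′ kG* n k = refl
family≡family′ kH  n k = refl

fwdU-0 : ∀ j → fwdU 0 j ≡ true ⊎ even j ≡ true
fwdU-0 j with even j
... | true  = inj₂ refl
... | false = inj₁ refl

profile : ∀ t k r → 1 ≤ k → Profile (family′ t k (Shape.top k r)) t k r
profile kE k r 1≤k =
  record { outs = outSide ; ins = inSide (cong (_+ (2 + r)) (count-none (2 * k) (λ _ _ → refl))) }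
  where open EF-Analysis k r 1≤k fwdTrans (λ _ → refl) (λ _ → inj₁ refl)
profile kF k r 1≤k = record { outs = outSide ; ins = inSide count-in }
  where
  open EF-Analysis k r 1≤k fwdU (λ _ → refl) fwdU-0
  count-in : count (λ j → not (fwdU 0 (suc j))) (2 * k) + (2 + r) ≡ 2 + (k + r)
  count-in = begin
    count (λ j → not (fwdU 0 (suc j))) (2 * k) + (2 + r)
      ≡⟨ cong (_+ (2 + r)) (count-cong (2 * k) (λ j _ → not-involutive (odd j))) ⟩
    count odd (2 * k) + (2 + r)                            ≡⟨ cong (_+ (2 + r)) (count-odd-double k) ⟩
    k + (2 + r)                                            ≡⟨ +-suc k (suc r) ⟩
    suc (k + suc r)                                        ≡⟨ cong suc (+-suc k r) ⟩
    2 + (k + r)                                            ∎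
    where open ≡-Reasoning
profile kF* k r 1≤k = record { outs = ins (profile kF k r 1≤k) ; ins = outs (profile kF k r 1≤k) }
profile kG k r 1≤k = record { outs = outSide ; ins = inSide }
  where open G-Analysis k r 1≤k
profile kG* k r 1≤k = record { outs = ins (profile kG k r 1≤k) ; ins = outs (profile kG k r 1≤k) }
profile kH k r 1≤k = record { outs = outSide ; ins = inSide }
  where open H-Analysis k r 1≤k

1+k≢2+[k+r] : ∀ k r → suc k ≢ 2 + (k + r)
1+k≢2+[k+r] k r e = m≢1+m+n k (suc-injective e)

r≢k+r : ∀ {k} r → 1 ≤ k → r ≢ k + r
r≢k+r r (s≤s _) = m≢1+n+m r

profiles-agree : ∀ {m} {T T′ : Tournament m} {t t′ k k′ r r′} → T ≅ T′ →
  Profile T t k r → Profile T′ t′ k′ r′ →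
  Agree (outSignature t k r) (outSignature t′ k′ r′) × Agree (inSignature t k r) (inSignature t′ k′ r′)
profiles-agree {T = T} iso P P′ =
  sides-agree (outs (profile-≅ {T = T} iso P)) (outs P′) ,
  sides-agree (ins (profile-≅ {T = T} iso P)) (ins P′)

kind-determined : ∀ t t′ {k k′ r r′} → 1 ≤ k → 1 ≤ k′ → k + r ≡ k′ + r′ →
  Agree (outSignature t k r) (outSignature t′ k′ r′) × Agree (inSignature t k r) (inSignature t′ k′ r′) →
  t ≡ t′ × k ≡ k′
kind-determined kE  kE  _ _ _ ((_ , e) , _) = refl , suc-injective e
kind-determined kF  kF  _ _ _ ((_ , e) , _) = refl , suc-injective e
kind-determined kF* kF* _ _ _ (_ , (_ , e)) = refl , suc-injective e
kind-determined kG  kG  _ _ _ (_ , (_ , e)) = refl , suc-injective e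
kind-determined kG* kG* _ _ _ ((_ , e) , _) = refl , suc-injective e
kind-determined kH  kH  _ _ _ ((_ , inj₁ ()) , _)
kind-determined kH  kH  {k} {k′} {r} _ _ s ((_ , inj₂ e) , _) =
  refl , +-cancelʳ-≡ r k k′ (trans s (cong (k′ +_) (sym (suc-injective (suc-injective e)))))
kind-determined kE  kF  {r = r} 1≤k _ s (_ , (_ , e)) =
  ⊥-elim (r≢k+r r 1≤k (trans (suc-injective (suc-injective e)) (sym s)))
kind-determined kF  kE  {r′ = r′} _ 1≤k′ s (_ , (_ , e)) =
  ⊥-elim (r≢k+r r′ 1≤k′ (sym (trans (sym s) (suc-injective (suc-injective e)))))
kind-determined kE  kF* {k} {r = r} _ _ s ((_ , e) , _) = ⊥-elim (1+k≢2+[k+r] k r (trans e (cong (2 +_) (sym s))))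
kind-determined kF  kF* {k} {r = r} _ _ s ((_ , e) , _) = ⊥-elim (1+k≢2+[k+r] k r (trans e (cong (2 +_) (sym s))))
kind-determined kF* kE  {k′ = k′} {r′ = r′} _ _ s ((_ , e) , _) =
  ⊥-elim (1+k≢2+[k+r] k′ r′ (sym (trans (cong (2 +_) (sym s)) e)))
kind-determined kF* kF  {k′ = k′} {r′ = r′} _ _ s ((_ , e) , _) =
  ⊥-elim (1+k≢2+[k+r] k′ r′ (sym (trans (cong (2 +_) (sym s)) e)))
kind-determined kE  kG  _ _ _ ((() , _) , _)
kind-determined kE  kG* _ _ _ (_ , (() , _))
kind-determined kE  kH  _ _ _ ((() , _) , _)
kind-determined kF  kG  _ _ _ ((() , _) , _)
kind-determined kF  kG* _ _ _ (_ , (() , _))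
kind-determined kF  kH  _ _ _ ((() , _) , _)
kind-determined kF* kG  _ _ _ ((() , _) , _)
kind-determined kF* kG* _ _ _ (_ , (() , _))
kind-determined kF* kH  _ _ _ ((() , _) , _)
kind-determined kG  kE  _ _ _ ((() , _) , _)
kind-determined kG  kF  _ _ _ ((() , _) , _)
kind-determined kG  kF* _ _ _ ((() , _) , _)
kind-determined kG  kG* _ _ _ ((() , _) , _)
kind-determined kG  kH  _ _ _ (_ , (() , _))
kind-determined kG* kE  _ _ _ (_ , (() , _))
kind-determined kG* kF  _ _ _ (_ , (() , _))
kind-determined kG* kF* _ _ _ (_ , (() , _))
kind-determined kG* kG  _ _ _ ((() , _) , _)
kind-determined kG* kH  _ _ _ ((() , _) , _)
kind-determined kH  kE  _ _ _ ((() , _) , _)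
kind-determined kH  kF  _ _ _ ((() , _) , _)
kind-determined kH  kF* _ _ _ ((() , _) , _)
kind-determined kH  kG  _ _ _ (_ , (() , _))
kind-determined kH  kG* _ _ _ ((() , _) , _)

double-layout : ∀ k r → 2 * (2 + (k + r)) ≡ suc (suc (2 * k + (2 + 2 * r)))
double-layout = solve-∀

top-decomposition : ∀ n k → 2 ≤ n → k ≤ n ∸ 2 → ∃ λ r → 2 * n ≡ Shape.top k r × k + r ≡ n ∸ 2
top-decomposition n k 2≤n k≤ = n ∸ 2 ∸ k , 2n≡top , m+[n∸m]≡n k≤
  where
  open ≡-Reasoning
  2n≡top : 2 * n ≡ Shape.top k (n ∸ 2 ∸ k)
  2n≡top = begin
    2 * n                            ≡⟨ cong (2 *_) (m+[n∸m]≡n 2≤n) ⟨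
    2 * (2 + (n ∸ 2))                ≡⟨ cong (λ m → 2 * (2 + m)) (m+[n∸m]≡n k≤) ⟨
    2 * (2 + (k + (n ∸ 2 ∸ k)))      ≡⟨ double-layout k (n ∸ 2 ∸ k) ⟩
    Shape.top k (n ∸ 2 ∸ k)          ∎

family-profile : ∀ t n k r → 1 ≤ k → 2 * n ≡ Shape.top k r → Profile (family t n k) t k r
family-profile t n k r 1≤k 2n≡top =
  subst (λ T → Profile T t k r) (sym (family≡family′ t n k))
        (subst (λ N → Profile (family′ t k N) t k r) (sym 2n≡top) (profile t k r 1≤k))

corollary4p2 : (n : ℕ) → 3 ≤ n →
    (t t' : Kind) (k k' : ℕ) →
    1 ≤ k → k ≤ n ∸ 2 → 1 ≤ k' → k' ≤ n ∸ 2 →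
    family t n k ≅ family t' n k' → (t ≡ t') × (k ≡ k')
corollary4p2 n 3≤n t t′ k k′ 1≤k k≤ 1≤k′ k′≤ iso
  with top-decomposition n k (≤-trans (n≤1+n 2) 3≤n) k≤
     | top-decomposition n k′ (≤-trans (n≤1+n 2) 3≤n) k′≤
... | r , 2n≡top , k+r≡ | r′ , 2n≡top′ , k′+r′≡ =
  kind-determined t t′ 1≤k 1≤k′ (trans k+r≡ (sym k′+r′≡))
    (profiles-agree iso (family-profile t n k r 1≤k 2n≡top) (family-profile t′ n k′ r′ 1≤k′ 2n≡top′))
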